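{- Let $G$ be a finite simple graph. Then the set of weight functions $w:V(G)\to\mathbb{R}$ such that $G$ is $w$-well-dominated is a vector space (a linear subspace of $\mathbb{R}^{V(G)}$).
   Context: For $w:V(G)\to\mathbb{R}$ and $S\subseteq V(G)$, $w(S)=\sum_{s\in S}w(s)$. A set $S\subseteq V(G)$ is dominating if every vertex is in $S$ or adjacent to a vertex of $S$; it is a minimal dominating set if it contains no other dominating set. $G$ is $w$-well-dominated if all minimal dominating sets of $G$ have the same weight $w(S)$. -}

module Defs where

open import Level using (Level; _⊔_) renaming (suc to lsuc; zero to lzero)
open import Data.Nat using (ℕ; zero; suc)
open import Data.Fin using (Fin; zero; suc)
open import Data.Fin.Subset using (Subset; _∈_; _∉_; _⊆_)
open import Data.Vec using (Vec; []; _∷_)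
open import Data.Bool using (Bool; true; false)
open import Data.Product using (Σ; ∃; _×_; _,_)
open import Data.Sum using (_⊎_)
open import Relation.Nullary using (¬_)
open import Relation.Binary.PropositionalEquality using (_≡_)
open import Algebra.Bundles using (CommutativeRing)

record Graph (n : ℕ) : Set₁ where
  field
    Adj     : Fin n → Fin n → Set
    symmetric   : ∀ {u v} → Adj u v → Adj v u
    irreflexive : ∀ {v} → ¬ Adj v v
open Graph public

Dominating : {n : ℕ} → Graph n → Subset n → Set
Dominating G S = ∀ v → v ∈ S ⊎ (∃ λ u → u ∈ S × Adj G u v)

MinimalDominating : {n : ℕ} → Graph n → Subset n → Set
MinimalDominating G S =
  Dominating G S × (∀ T → T ⊆ S → Dominating G T → T ≡ S)

module _ {c ℓ : Level} (R : CommutativeRing c ℓ) where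
  open CommutativeRing R using (Carrier; _≈_; _+_; _*_; 0#)

  weight : {n : ℕ} → (Fin n → Carrier) → Subset n → Carrier
  weight {zero}  w []            = 0#
  weight {suc n} w (true  ∷ S) = w zero + weight (λ i → w (suc i)) S
  weight {suc n} w (false ∷ S) = weight (λ i → w (suc i)) S

  WellDominated : {n : ℕ} → Graph n → (Fin n → Carrier) → Set ℓ
  WellDominated G w =
    ∀ S T → MinimalDominating G S → MinimalDominating G T → weight w S ≈ weight w T

  IsSubspace : {n : ℕ} → ((Fin n → Carrier) → Set ℓ) → Set (c ⊔ ℓ)
  IsSubspace P =
    P (λ _ → 0#)
    × (∀ w w' → P w → P w' → P (λ i → w i + w' i))
    × (∀ a w → P w → P (λ i → a * w i))

module Submission where

-- The weight w(S) is linear in w, so for fixed S and T the condition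
-- w(S) = w(T) cuts out a linear subspace; being w-well-dominated is the
-- intersection of these conditions over all pairs of minimal dominating sets.

open import Defs
open import Level using (Level)
open import Data.Nat using (ℕ)
open import Data.Fin using (Fin; zero; suc)
open import Data.Fin.Subset using (Subset)
open import Data.Vec using ([]; _∷_)
open import Data.Bool using (true; false)
open import Data.Product using (_,_)
open import Algebra.Bundles using (CommutativeRing)
import Algebra.Properties.CommutativeSemigroup as CommutativeSemigroupProperties
import Relation.Binary.Reasoning.Setoid as ≈-Reasoning

module WeightLinearity {c ℓ : Level} (R : CommutativeRing c ℓ) where
  open CommutativeRing R hiding (zero)
  open CommutativeSemigroupProperties +-commutativeSemigroup using (interchange)

  weight-0 : {n : ℕ} (S : Subset n) → weight R (λ _ → 0#) S ≈ 0#
  weight-0 []          = refl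
  weight-0 (true  ∷ S) = trans (+-cong refl (weight-0 S)) (+-identityʳ 0#)
  weight-0 (false ∷ S) = weight-0 S

  weight-+ : {n : ℕ} (w w′ : Fin n → Carrier) (S : Subset n) →
             weight R (λ i → w i + w′ i) S ≈ weight R w S + weight R w′ S
  weight-+ w w′ []          = sym (+-identityʳ 0#)
  weight-+ w w′ (true  ∷ S) =
    trans (+-cong refl (weight-+ (λ i → w (suc i)) (λ i → w′ (suc i)) S))
          (interchange (w zero) (w′ zero) _ _)
  weight-+ w w′ (false ∷ S) = weight-+ (λ i → w (suc i)) (λ i → w′ (suc i)) S

  weight-* : {n : ℕ} (a : Carrier) (w : Fin n → Carrier) (S : Subset n) →
             weight R (λ i → a * w i) S ≈ a * weight R w S
  weight-* a w []          = sym (zeroʳ a)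
  weight-* a w (true  ∷ S) =
    trans (+-cong refl (weight-* a (λ i → w (suc i)) S)) (sym (distribˡ a _ _))
  weight-* a w (false ∷ S) = weight-* a (λ i → w (suc i)) S

  ConstantWeightOn : {n : ℕ} → (Subset n → Set) → (Fin n → Carrier) → Set ℓ
  ConstantWeightOn Q w = ∀ S T → Q S → Q T → weight R w S ≈ weight R w T

  constantWeightOn-isSubspace : {n : ℕ} (Q : Subset n → Set) →
                                IsSubspace R (ConstantWeightOn Q)
  constantWeightOn-isSubspace Q = zero-closed , +-closed , *-closed
    where
    zero-closed : ConstantWeightOn Q (λ _ → 0#)
    zero-closed S T _ _ = trans (weight-0 S) (sym (weight-0 T))

    +-closed : ∀ w w′ → ConstantWeightOn Q w → ConstantWeightOn Q w′ →
               ConstantWeightOn Q (λ i → w i + w′ i)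
    +-closed w w′ const const′ S T QS QT = begin
      weight R (λ i → w i + w′ i) S        ≈⟨ weight-+ w w′ S ⟩
      weight R w S + weight R w′ S         ≈⟨ +-cong (const S T QS QT) (const′ S T QS QT) ⟩
      weight R w T + weight R w′ T         ≈⟨ weight-+ w w′ T ⟨
      weight R (λ i → w i + w′ i) T        ∎
      where open ≈-Reasoning setoid

    *-closed : ∀ a w → ConstantWeightOn Q w → ConstantWeightOn Q (λ i → a * w i)
    *-closed a w const S T QS QT = begin
      weight R (λ i → a * w i) S           ≈⟨ weight-* a w S ⟩
      a * weight R w S                     ≈⟨ *-cong refl (const S T QS QT) ⟩
      a * weight R w T                     ≈⟨ weight-* a w T ⟨
      weight R (λ i → a * w i) T           ∎
      where open ≈-Reasoning setoid

theorem5 : {c ℓ : Level} (R : CommutativeRing c ℓ) {n : ℕ} (G : Graph n) →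
    IsSubspace R (WellDominated R G)
theorem5 R G = constantWeightOn-isSubspace (MinimalDominating G)
  where open WeightLinearity R
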